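{- Let $P$ be a path in $\Gamma_5$, decomposed into conveyor belts, ladders and chutes. (a) If $P=P'\,L\,P''$ where $L$ is a ladder and $P''$ contains no ladders and at least one chute, then $P''$ begins with a square-to-square conveyor belt. (b) If $P=P'\,C\,P''$ where $C$ is a chute and $P'$ contains no chutes and at least one ladder, then $P'$ ends with a square-to-square conveyor belt. (c) If $P=L\,P'\,C$ where $L$ is a ladder and $C$ is a chute, then $P'$ contains a square-to-square conveyor belt as a subpath.
   Context: Define sets of positive integers $R_1,R_2,\dots$ recursively: $R_1=\{2\}$; if $x\in R_k$ then $(x+5)^2\in R_{k+1}$; if $x^2\in R_k$ then $x\in R_{k+1}$. Let $S=\bigcup_i R_i$. The directed graph $\Gamma_5$ has vertex set $S$, up-edges $U$: $(n,(n+5)^2)$ for $n\in S$, and down-edges $D$: $(n^2,n)$ for $n\in S$. A path is a directed walk, recorded as a word in $U,D$. A conveyor belt is a subpath of the form $(UD)^i$, $i\ge1$; a ladder is a subpath $U^i$, $i\ge1$; a chute is a subpath $D^i$, $i\ge 1$. Every path decomposes as follows: its maximal subpaths of the form $(UD)^i$ are its conveyor belts; each remaining maximal segment contains no $UD$ and so is of the form $U^i$ (a ladder), $D^i$ (a chute), or $D^nU^m$ (a chute followed by a ladder). A conveyor belt is square-to-square if it both begins and ends at a perfect square. -}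

module Defs where

open import Data.Nat using (ℕ; zero; suc; _+_; _*_; _^_; _≤_; _<_)
open import Data.List using (List; []; _∷_; length)
open import Data.Maybe using (Maybe; just; nothing)
open import Data.Product using (Σ; ∃; ∃-syntax; _×_; _,_)
open import Relation.Nullary using (¬_)
open import Relation.Binary.PropositionalEquality using (_≡_)

-- The sets R_k (k ≥ 1), as an inductive family: R k x means x ∈ R_k.
data R : ℕ → ℕ → Set where
  base : R 1 2
  up   : ∀ {k x} → R k x → R (suc k) ((x + 5) ^ 2)
  down : ∀ {k x} → R k (x ^ 2) → R (suc k) x

S : ℕ → Set
S x = ∃[ k ] R k x

data Step : Set where
  U D : Step

Edge : Step → ℕ → ℕ → Set
Edge U x y = S x × S y × y ≡ (x + 5) ^ 2
Edge D x y = S x × S y × x ≡ y ^ 2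

at : List Step → ℕ → Maybe Step
at []       _       = nothing
at (s ∷ ss) zero    = just s
at (s ∷ ss) (suc i) = at ss i

-- A path in Γ_5: word w together with its vertex sequence v 0, v 1, …, v (length w);
-- step i goes from v i to v (i+1).  (Values v j for j > length w are irrelevant.)
IsPath : List Step → (ℕ → ℕ) → Set
IsPath w v = S (v 0) × (∀ i s → at w i ≡ just s → Edge s (v i) (v (suc i)))

IsSquare : ℕ → Set
IsSquare m = ∃[ k ] m ≡ k ^ 2

-- Subpath occupying step positions a, …, b-1 has the form (UD)^i, i ≥ 1.
UDPat : List Step → ℕ → ℕ → Set
UDPat w a b = ∃[ i ] (1 ≤ i × b ≡ a + 2 * i ×
  (∀ t → t < i → at w (a + 2 * t) ≡ just U × at w (suc (a + 2 * t)) ≡ just D))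

Belt : List Step → ℕ → ℕ → Set
Belt w a b = UDPat w a b ×
  (∀ c d → UDPat w c d → c ≤ a → b ≤ d → c ≡ a × d ≡ b)

Covered : List Step → ℕ → Set
Covered w p = ∃[ a ] ∃[ b ] (Belt w a b × a ≤ p × p < b)

Run : Step → List Step → ℕ → ℕ → Set
Run s w a b = a < b × (∀ p → a ≤ p → p < b → at w p ≡ just s × ¬ Covered w p)

MaxRun : Step → List Step → ℕ → ℕ → Set
MaxRun s w a b = Run s w a b × (∀ c d → Run s w c d → c ≤ a → b ≤ d → c ≡ a × d ≡ b)

-- Ladders / chutes of the decomposition: the U^m / D^n parts of the maximal
-- segments (of the form D^n U^m) left after removing the conveyor belts.
Ladder : List Step → ℕ → ℕ → Set
Ladder = MaxRun U

Chute : List Step → ℕ → ℕ → Set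
Chute = MaxRun D

SqBelt : List Step → (ℕ → ℕ) → ℕ → ℕ → Set
SqBelt w v a b = Belt w a b × IsSquare (v a) × IsSquare (v b)

-- A vertex entered by an up-edge is a square (x + 5)², and a vertex left by a
-- down-edge is a square.  A letter lies in a conveyor belt exactly when it is
-- part of an adjacent UD.  Hence the letter after the last U of a ladder is
-- again a U, which either continues a ladder or starts a belt, and that belt
-- ends either just before a D — so it is square-to-square — or just before a U
-- that starts a new ladder; symmetrically for the letter before the first D of
-- a chute.  Between a ladder and a later chute this process must stop at a
-- square-to-square belt, while in (a) and (b) a new ladder (chute) would
-- contradict the hypotheses.
module Submission where

open import Defs
open import Data.Nat using (ℕ; zero; suc; _+_; _*_; _⊓_; _⊔_; _≤_; _<_; z≤n; s≤s; z<s; _≤?_; _<?_)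
open import Data.Nat.Properties
open import Data.Nat.Tactic.RingSolver using (solve-∀)
open import Data.List using (List; _∷_; length)
open import Data.Maybe using (Maybe; just)
open import Data.Maybe.Properties using (≡-dec)
open import Data.Product using (∃-syntax; _×_; _,_; proj₁; proj₂)
open import Data.Sum using (_⊎_; inj₁; inj₂; [_,_])
open import Data.Empty using (⊥; ⊥-elim)
open import Relation.Nullary using (¬_; Dec; yes; no)
open import Relation.Nullary.Decidable using (map′; _×-dec_; _⊎-dec_; ¬?)
open import Relation.Binary.Definitions using (DecidableEquality)
open import Relation.Binary.PropositionalEquality using (_≡_; _≢_; refl; sym; trans; cong; subst)

_≟ₛ_ : DecidableEquality Step
U ≟ₛ U = yes refl
U ≟ₛ D = no λ ()
D ≟ₛ U = no λ ()
D ≟ₛ D = yes refl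

at-U≢D : ∀ {m : Maybe Step} → m ≡ just U → m ≡ just D → ⊥
at-U≢D refl ()

at⇒<length : ∀ w {p s} → at w p ≡ just s → p < length w
at⇒<length (_ ∷ _) {zero}  _ = s≤s z≤n
at⇒<length (_ ∷ w) {suc p} e = s≤s (at⇒<length w e)

<length⇒at : ∀ w {p} → p < length w → at w p ≡ just U ⊎ at w p ≡ just D
<length⇒at (U ∷ _) {zero}  _        = inj₁ refl
<length⇒at (D ∷ _) {zero}  _        = inj₂ refl
<length⇒at (_ ∷ w) {suc p} (s≤s lt) = <length⇒at w lt

<⇒∃suc≡ : ∀ {c a} → c < a → ∃[ z ] (suc z ≡ a × c ≤ z)
<⇒∃suc≡ (s≤s c≤z) = _ , refl , c≤z

m+2*[1+n]≡2+[m+2*n] : ∀ m n → m + 2 * suc n ≡ 2 + (m + 2 * n)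
m+2*[1+n]≡2+[m+2*n] = solve-∀

even⊎odd : ∀ n → ∃[ t ] (n ≡ 2 * t ⊎ n ≡ suc (2 * t))
even⊎odd zero = 0 , inj₁ refl
even⊎odd (suc n) with even⊎odd n
... | t , inj₁ refl = t , inj₂ refl
... | t , inj₂ refl = suc t , inj₁ (sym (*-suc 2 t))

UDAt : List Step → ℕ → Set
UDAt w r = at w r ≡ just U × at w (suc r) ≡ just D

UDAt? : ∀ w r → Dec (UDAt w r)
UDAt? w r = ≡-dec _≟ₛ_ (at w r) (just U) ×-dec ≡-dec _≟ₛ_ (at w (suc r)) (just D)

-- The letters of ladders and chutes: those lying in no conveyor belt.
Bare : Step → List Step → ℕ → Set
Bare s w p = at w p ≡ just s × ¬ Covered w p

-- Chosen so that Run s w a b unfolds to a < b × AllBare s w a b.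
AllBare : Step → List Step → ℕ → ℕ → Set
AllBare s w a b = ∀ p → a ≤ p → p < b → Bare s w p

module _ {w : List Step} where

  at-U-D⇒≢ : ∀ {i j} → at w i ≡ just U → at w j ≡ just D → i ≢ j
  at-U-D⇒≢ u d refl = at-U≢D u d

  at-below : ∀ {p q s} → p ≤ q → at w q ≡ just s → at w p ≡ just U ⊎ at w p ≡ just D
  at-below p≤q e = <length⇒at w (≤-<-trans p≤q (at⇒<length w e))

  square-after-U : ∀ {v p} → IsPath w v → at w p ≡ just U → IsSquare (v (suc p))
  square-after-U {v} {p} (_ , edge) e = v p + 5 , proj₂ (proj₂ (edge p U e))

  square-before-D : ∀ {v p} → IsPath w v → at w p ≡ just D → IsSquare (v p)
  square-before-D {v} {p} (_ , edge) e = v (suc p) , proj₂ (proj₂ (edge p D e))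

  udPat-single : ∀ {r} → UDAt w r → UDPat w r (2 + r)
  udPat-single {r} ud = 1 , ≤-refl , +-comm 2 r , λ where
    zero    _        → subst (UDAt w) (sym (+-identityʳ r)) ud
    (suc _) (s≤s ())

  udPat-extendʳ : ∀ {a b} → UDPat w a b → UDAt w b → UDPat w a (2 + b)
  udPat-extendʳ {a} (i , _ , refl , f) ud = suc i , s≤s z≤n , sym (m+2*[1+n]≡2+[m+2*n] a i) , g
    where
    g : ∀ t → t < suc i → UDAt w (a + 2 * t)
    g t t<1+i with m<1+n⇒m<n∨m≡n t<1+i
    ... | inj₁ t<i  = f t t<i
    ... | inj₂ refl = ud

  udPat-extendˡ : ∀ {z b} → UDAt w z → UDPat w (2 + z) b → UDPat w z b
  udPat-extendˡ {z} ud (i , _ , refl , f) = suc i , s≤s z≤n , sym (m+2*[1+n]≡2+[m+2*n] z i) , g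
    where
    g : ∀ t → t < suc i → UDAt w (z + 2 * t)
    g zero    _         = subst (UDAt w) (sym (+-identityʳ z)) ud
    g (suc t) (s≤s t<i) = subst (UDAt w) (sym (m+2*[1+n]≡2+[m+2*n] z t)) (f t t<i)

  udPat-nonempty : ∀ {a b} → UDPat w a b → a < b
  udPat-nonempty {a} (suc _ , _ , refl , _) = m<m+n a z<s

  udPat-first : ∀ {a b} → UDPat w a b → at w a ≡ just U
  udPat-first {a} (_ , 1≤i , _ , f) = subst (λ r → at w r ≡ just U) (+-identityʳ a) (proj₁ (f 0 1≤i))

  udPat-last : ∀ {a b} → UDPat w a b → ∃[ r ] (b ≡ suc r × at w r ≡ just D)
  udPat-last {a} (suc i , _ , refl , f) = suc (a + 2 * i) , m+2*[1+n]≡2+[m+2*n] a i , proj₂ (f i ≤-refl)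

  udPat-position : ∀ {a b r} → UDPat w a b → a ≤ r → r < b →
    UDAt w r ⊎ ∃[ r′ ] (r ≡ suc r′ × UDAt w r′)
  udPat-position {a} (i , _ , refl , f) a≤r r<b with m≤n⇒∃[o]m+o≡n a≤r
  ... | k , refl with even⊎odd k
  ... | t , inj₁ refl = inj₁ (f t (*-cancelˡ-< 2 t i (+-cancelˡ-< a (2 * t) (2 * i) r<b)))
  ... | t , inj₂ refl = inj₂ (a + 2 * t , +-suc a (2 * t) , f t t<i)
    where
    t<i : t < i
    t<i = *-cancelˡ-< 2 t i (<-trans (n<1+n _) (+-cancelˡ-< a (suc (2 * t)) (2 * i) r<b))

  belt-stopsʳ : ∀ {a b} → Belt w a b → ¬ UDAt w b
  belt-stopsʳ {a} {b} (P , maximal) ud =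
    <-irrefl (sym (proj₂ (maximal a (2 + b) (udPat-extendʳ {a} P ud) ≤-refl (m≤n+m b 2)))) (m<n+m b z<s)

  belt-stopsˡ : ∀ {z b} → Belt w (2 + z) b → ¬ UDAt w z
  belt-stopsˡ {z} {b} (P , maximal) ud =
    <-irrefl (proj₁ (maximal z b (udPat-extendˡ ud P) (m≤n+m z 2) ≤-refl)) (m<n+m z z<s)

  udPat⇒belt : ∀ {a b} → UDPat w a b → (∀ z → 2 + z ≡ a → ¬ UDAt w z) → ¬ UDAt w b → Belt w a b
  udPat⇒belt {a} {b} P stopˡ stopʳ = P , λ c d Q c≤a b≤d → start Q c≤a b≤d , end Q c≤a b≤d
    where
    start : ∀ {c d} → UDPat w c d → c ≤ a → b ≤ d → c ≡ a
    start {c} {d} Q c≤a b≤d with m≤n⇒m<n∨m≡n c≤a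
    ... | inj₂ c≡a = c≡a
    ... | inj₁ c<a with <⇒∃suc≡ c<a
    ...   | z , 1+z≡a , c≤z
            with udPat-position Q c≤z (subst (_≤ d) (sym 1+z≡a) (≤-trans (<⇒≤ (udPat-nonempty P)) b≤d))
    ...     | inj₁ (_ , 1+zD) = ⊥-elim (at-U≢D (subst (λ i → at w i ≡ just U) (sym 1+z≡a) (udPat-first P)) 1+zD)
    ...     | inj₂ (r , z≡1+r , ud) = ⊥-elim (stopˡ r (trans (cong suc (sym z≡1+r)) 1+z≡a) ud)
    end : ∀ {c d} → UDPat w c d → c ≤ a → b ≤ d → d ≡ b
    end {c} {d} Q c≤a b≤d with m≤n⇒m<n∨m≡n b≤d
    ... | inj₂ b≡d = sym b≡d
    ... | inj₁ b<d with udPat-position {c} Q (≤-trans c≤a (<⇒≤ (udPat-nonempty {a} P))) b<d | udPat-last {a} P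
    ...   | inj₁ ud                    | _              = ⊥-elim (stopʳ ud)
    ...   | inj₂ (r′ , b≡1+r′ , u , _) | r , b≡1+r , rD =
            ⊥-elim (at-U-D⇒≢ u rD (suc-injective (trans (sym b≡1+r′) b≡1+r)))

  udPat-growʳ : ∀ n {a b} → length w ≤ b + n → UDPat w a b →
    ∃[ b′ ] (UDPat w a b′ × b ≤ b′ × ¬ UDAt w b′)
  udPat-growʳ n {b = b} bound P with UDAt? w b
  ... | no ¬ud = b , P , ≤-refl , ¬ud
  udPat-growʳ zero {b = b} bound P | yes (bU , _) =
    ⊥-elim (<⇒≱ (at⇒<length w bU) (subst (length w ≤_) (+-identityʳ b) bound))
  udPat-growʳ (suc n) {a} {b} bound P | yes ud
    with udPat-growʳ n {a} (≤-trans bound (≤-trans (≤-reflexive (+-suc b n)) (n≤1+n _))) (udPat-extendʳ {a} P ud)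
  ... | b′ , P′ , 2+b≤b′ , stop = b′ , P′ , ≤-trans (m≤n+m b 2) 2+b≤b′ , stop

  udPat-growˡ : ∀ a {b} → UDPat w a b →
    ∃[ a′ ] (UDPat w a′ b × a′ ≤ a × (∀ z → 2 + z ≡ a′ → ¬ UDAt w z))
  udPat-growˡ zero          P = 0 , P , ≤-refl , λ _ ()
  udPat-growˡ (suc zero)    P = 1 , P , ≤-refl , λ _ ()
  udPat-growˡ (suc (suc z)) P with UDAt? w z
  ... | no ¬ud =
    2 + z , P , ≤-refl , λ z′ e → subst (λ i → ¬ UDAt w i) (sym (suc-injective (suc-injective e))) ¬ud
  ... | yes ud with udPat-growˡ z (udPat-extendˡ ud P)
  ...   | a′ , P′ , a′≤z , stop = a′ , P′ , ≤-trans a′≤z (m≤n+m z 2) , stop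

  belt-around : ∀ {r} → UDAt w r → ∃[ x ] ∃[ y ] (Belt w x y × x ≤ r × 2 + r ≤ y)
  belt-around {r} ud with udPat-growˡ r (udPat-single ud)
  ... | x , P , x≤r , stopˡ with udPat-growʳ (length w) {x} (m≤n+m (length w) (2 + r)) P
  ...   | y , P′ , 2+r≤y , stopʳ = x , y , udPat⇒belt {x} P′ stopˡ stopʳ , x≤r , 2+r≤y

  UD⇒coveredˡ : ∀ {r} → UDAt w r → Covered w r
  UD⇒coveredˡ ud with belt-around ud
  ... | x , y , B , x≤r , 2+r≤y = x , y , B , x≤r , ≤-trans (n≤1+n _) 2+r≤y

  UD⇒coveredʳ : ∀ {r} → UDAt w r → Covered w (suc r)
  UD⇒coveredʳ {r} ud with belt-around ud
  ... | x , y , B , x≤r , 2+r≤y = x , y , B , ≤-trans x≤r (n≤1+n r) , 2+r≤y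

  covered⇒UD : ∀ {p} → Covered w p → UDAt w p ⊎ ∃[ r ] (p ≡ suc r × UDAt w r)
  covered⇒UD (_ , _ , (P , _) , x≤p , p<y) = udPat-position P x≤p p<y

  covered? : ∀ p → Dec (Covered w p)
  covered? p = map′ [ UD⇒coveredˡ , (λ (_ , e , ud) → subst (Covered w) (sym e) (UD⇒coveredʳ ud)) ]
                    covered⇒UD (UDAt? w p ⊎-dec ends-UD? p)
    where
    ends-UD? : ∀ p → Dec (∃[ r ] (p ≡ suc r × UDAt w r))
    ends-UD? zero    = no λ ()
    ends-UD? (suc r) = map′ (λ ud → r , refl , ud) (λ { (_ , refl , ud) → ud }) (UDAt? w r)

  covered-U⇒D : ∀ {p} → Covered w p → at w p ≡ just U → at w (suc p) ≡ just D
  covered-U⇒D c u with covered⇒UD c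
  ... | inj₁ (_ , d)              = d
  ... | inj₂ (_ , refl , (_ , d)) = ⊥-elim (at-U≢D u d)

  covered-D⇒U : ∀ {p} → Covered w p → at w p ≡ just D → ∃[ r ] (p ≡ suc r × at w r ≡ just U)
  covered-D⇒U c d with covered⇒UD c
  ... | inj₁ (u , _)           = ⊥-elim (at-U≢D u d)
  ... | inj₂ (r , e , (u , _)) = r , e , u

  belt-below : ∀ {x y q} → Belt w x y → ¬ Covered w q → q < y → q < x
  belt-below {x} {y} B q∉ q<y = ≰⇒> λ x≤q → q∉ (x , y , B , x≤q , q<y)

  belt-above : ∀ {x y q} → Belt w x y → ¬ Covered w q → x ≤ q → y ≤ q
  belt-above {x} {y} B q∉ x≤q = ≮⇒≥ λ q<y → q∉ (x , y , B , x≤q , q<y)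

  bare? : ∀ s p → Dec (Bare s w p)
  bare? s p = ≡-dec _≟ₛ_ (at w p) (just s) ×-dec ¬? (covered? p)

  U-after-belt⇒bare : ∀ {x y q s} → Belt w x y → at w y ≡ just U → y < q → at w q ≡ just s → Bare U w y
  U-after-belt⇒bare B yU y<q qs with at-below y<q qs
  ... | inj₂ 1+yD = ⊥-elim (belt-stopsʳ B (yU , 1+yD))
  ... | inj₁ 1+yU = yU , λ c → at-U≢D 1+yU (covered-U⇒D c yU)

  D-before-belt⇒bare : ∀ {x y} → Belt w (suc x) y → at w x ≡ just D → Bare D w x
  D-before-belt⇒bare {x} B xD = xD , x∉
    where
    x∉ : ¬ Covered w x
    x∉ c with covered-D⇒U c xD
    ... | _ , refl , u = belt-stopsˡ B (u , xD)

  sqBelt⊎bareU-after : ∀ {v p q} → IsPath w v → Bare U w p → Bare D w q → p < q →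
    (∃[ e ] (SqBelt w v (suc p) e × e ≤ q)) ⊎ (∃[ r ] (p < r × r < q × Bare U w r))
  sqBelt⊎bareU-after {v} {p} {q} path (pU , p∉) (qD , q∉) p<q with at-below p<q qD
  ... | inj₂ 1+pD = ⊥-elim (p∉ (UD⇒coveredˡ (pU , 1+pD)))
  ... | inj₁ 1+pU with covered? (suc p)
  ...   | no 1+p∉ = inj₂ (suc p , ≤-refl , ≤∧≢⇒< p<q (at-U-D⇒≢ 1+pU qD) , 1+pU , 1+p∉)
  ...   | yes (x , y , B , x≤1+p , 1+p<y)
          with ≤-antisym x≤1+p (belt-below B p∉ (<-trans (n<1+n p) 1+p<y))
  ...     | refl with belt-above B q∉ p<q
  ...       | y≤q with at-below y≤q qD
  ...         | inj₂ yD = inj₁ (y , (B , square-after-U path pU , square-before-D path yD) , y≤q)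
  ...         | inj₁ yU = inj₂ (y , <-trans (n<1+n p) 1+p<y , y<q , U-after-belt⇒bare B yU y<q qD)
    where
    y<q : y < q
    y<q = ≤∧≢⇒< y≤q (at-U-D⇒≢ yU qD)

  sqBelt⊎bareD-before : ∀ {v p q} → IsPath w v → ¬ Covered w p → Bare D w q → p < q →
    (∃[ x ] SqBelt w v x q) ⊎ (∃[ r ] (r < q × Bare D w r))
  sqBelt⊎bareD-before {v} {p} {suc q} path p∉ (1+qD , 1+q∉) (s≤s p≤q) with at-below (n≤1+n q) 1+qD
  ... | inj₁ qU = ⊥-elim (1+q∉ (UD⇒coveredʳ (qU , 1+qD)))
  ... | inj₂ qD with covered? q
  ...   | no q∉ = inj₂ (q , ≤-refl , qD , q∉)
  ...   | yes (x , y , B , x≤q , q<y)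
          with ≤-antisym (belt-above B 1+q∉ (≤-trans x≤q (n≤1+n q))) q<y
  ...     | refl with belt-below B p∉ (≤-<-trans p≤q q<y)
  ...       | s≤s {n = x′} _ with at-below (<⇒≤ (<-trans (n<1+n x′) (udPat-nonempty (proj₁ B)))) 1+qD
  ...         | inj₁ x′U = inj₁ (suc x′ , B , square-after-U path x′U , square-before-D path 1+qD)
  ...         | inj₂ x′D =
                inj₂ (x′ , <-trans (n<1+n x′) (udPat-nonempty (proj₁ B)) , D-before-belt⇒bare B x′D)

  allBare-single : ∀ {s r} → Bare s w r → AllBare s w r (suc r)
  allBare-single {s} br q r≤q q<1+r = subst (Bare s w) (≤-antisym r≤q (m<1+n⇒m≤n q<1+r)) br

  allBare-extendʳ : ∀ {s a b} → AllBare s w a b → Bare s w b → AllBare s w a (suc b)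
  allBare-extendʳ f bb q a≤q q<1+b with m<1+n⇒m<n∨m≡n q<1+b
  ... | inj₁ q<b  = f q a≤q q<b
  ... | inj₂ refl = bb

  allBare-extendˡ : ∀ {s z b} → Bare s w z → AllBare s w (suc z) b → AllBare s w z b
  allBare-extendˡ bz f q z≤q q<b with m≤n⇒m<n∨m≡n z≤q
  ... | inj₁ z<q  = f q z<q q<b
  ... | inj₂ refl = bz

  allBare-growʳ : ∀ {s} n {a b} → length w ≤ b + n → AllBare s w a b →
    ∃[ b′ ] (b ≤ b′ × AllBare s w a b′ × ¬ Bare s w b′)
  allBare-growʳ {s} n {b = b} bound f with bare? s b
  ... | no ¬bb = b , ≤-refl , f , ¬bb
  allBare-growʳ zero {b = b} bound f | yes (bs , _) =
    ⊥-elim (<⇒≱ (at⇒<length w bs) (subst (length w ≤_) (+-identityʳ b) bound))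
  allBare-growʳ {s} (suc n) {a} {b} bound f | yes bb
    with allBare-growʳ {s} n {a} (subst (length w ≤_) (+-suc b n) bound) (allBare-extendʳ f bb)
  ... | b′ , 1+b≤b′ , f′ , stop = b′ , ≤-trans (n≤1+n b) 1+b≤b′ , f′ , stop

  allBare-growˡ : ∀ {s} a {b} → AllBare s w a b →
    ∃[ a′ ] (a′ ≤ a × AllBare s w a′ b × (∀ z → suc z ≡ a′ → ¬ Bare s w z))
  allBare-growˡ zero f = 0 , ≤-refl , f , λ _ ()
  allBare-growˡ {s} (suc z) {b} f with bare? s z
  ... | no ¬bz = suc z , ≤-refl , f , λ z′ e → subst (λ i → ¬ Bare s w i) (sym (suc-injective e)) ¬bz
  ... | yes bz with allBare-growˡ {s} z {b} (allBare-extendˡ bz f)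
  ...   | a′ , a′≤z , f′ , stop = a′ , ≤-trans a′≤z (n≤1+n z) , f′ , stop

  run⇒maxRun : ∀ {s a b} → Run s w a b →
    (∀ z → suc z ≡ a → ¬ Bare s w z) → ¬ Bare s w b → MaxRun s w a b
  run⇒maxRun {s} {a} {b} (a<b , f) stopˡ stopʳ =
    (a<b , f) , λ c d R c≤a b≤d → start R c≤a b≤d , end R c≤a b≤d
    where
    start : ∀ {c d} → Run s w c d → c ≤ a → b ≤ d → c ≡ a
    start {c} {d} (_ , g) c≤a b≤d with m≤n⇒m<n∨m≡n c≤a
    ... | inj₂ c≡a = c≡a
    ... | inj₁ c<a with <⇒∃suc≡ c<a
    ...   | z , 1+z≡a , c≤z =
            ⊥-elim (stopˡ z 1+z≡a (g z c≤z (subst (_≤ d) (sym 1+z≡a) (≤-trans (<⇒≤ a<b) b≤d))))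
    end : ∀ {c d} → Run s w c d → c ≤ a → b ≤ d → d ≡ b
    end {c} {d} (_ , g) c≤a b≤d with m≤n⇒m<n∨m≡n b≤d
    ... | inj₂ b≡d = sym b≡d
    ... | inj₁ b<d = ⊥-elim (stopʳ (g b (≤-trans c≤a (<⇒≤ a<b)) b<d))

  maxRun-around : ∀ {s r} → Bare s w r → ∃[ c ] ∃[ d ] (MaxRun s w c d × c ≤ r × r < d)
  maxRun-around {s} {r} br with allBare-growˡ {s} r (allBare-single br)
  ... | c , c≤r , f , stopˡ with allBare-growʳ {s} (length w) {c} (m≤n+m (length w) (suc r)) f
  ...   | d , r<d , f′ , stopʳ = c , d , run⇒maxRun (≤-<-trans c≤r r<d , f′) stopˡ stopʳ , c≤r , r<d

  run-union : ∀ {s a b c d} → Run s w a b → Run s w c d → c ≤ b → a ≤ d → Run s w (a ⊓ c) (b ⊔ d)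
  run-union {s} {a} {b} {c} {d} (a<b , f) (_ , g) c≤b a≤d =
    ≤-<-trans (m⊓n≤m a c) (<-≤-trans a<b (m≤m⊔n b d)) , union
    where
    union : AllBare s w (a ⊓ c) (b ⊔ d)
    union q lo hi with a ≤? q | q <? b
    ... | yes a≤q | yes q<b = f q a≤q q<b
    ... | yes _   | no q≮b  =
      g q (≤-trans c≤b (≮⇒≥ q≮b)) (≰⇒> λ d≤q → <⇒≱ hi (⊔-lub (≮⇒≥ q≮b) d≤q))
    ... | no a≰q  | _       =
      g q (≮⇒≥ λ q<c → <⇒≱ (⊓-glb (≰⇒> a≰q) q<c) lo) (<-≤-trans (≰⇒> a≰q) a≤d)

  maxRun-absorbs : ∀ {s a b c d} → MaxRun s w a b → Run s w c d → c ≤ b → a ≤ d → a ≤ c × d ≤ b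
  maxRun-absorbs {a = a} {b} {c} {d} (R , maximal) R′ c≤b a≤d
    with maximal (a ⊓ c) (b ⊔ d) (run-union R R′ c≤b a≤d) (m⊓n≤m a c) (m≤m⊔n b d)
  ... | a⊓c≡a , b⊔d≡b = m⊓n≡m⇒m≤n a⊓c≡a , m⊔n≡m⇒n≤m b⊔d≡b

  sqBelt-between : ∀ {v p q} → IsPath w v → Bare U w p → Bare D w q → p < q →
    ∃[ c ] ∃[ d ] (SqBelt w v c d × p < c × d ≤ q)
  sqBelt-between {v} {p} {q} path pU qD p<q = go q (m≤n+m q p) pU p<q
    where
    go : ∀ {i} n → q ≤ i + n → Bare U w i → i < q → ∃[ c ] ∃[ d ] (SqBelt w v c d × i < c × d ≤ q)
    go {i} zero q≤i _ i<q = ⊥-elim (<⇒≱ i<q (subst (q ≤_) (+-identityʳ i) q≤i))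
    go {i} (suc n) q≤i+1+n iU i<q with sqBelt⊎bareU-after path iU qD i<q
    ... | inj₁ (e , sq , e≤q) = suc i , e , sq , ≤-refl , e≤q
    ... | inj₂ (r , i<r , r<q , rU)
          with go n (≤-trans q≤i+1+n (≤-trans (≤-reflexive (+-suc i n)) (+-monoˡ-≤ n i<r))) rU r<q
    ...   | c , d , sq , r<c , d≤q = c , d , sq , <-trans i<r r<c , d≤q

  sqBelt-after-last-ladder : ∀ {v a b} → IsPath w v → Ladder w a b →
    (∀ c d → Ladder w c d → b ≤ c → ⊥) → ∃[ c ] ∃[ d ] (Chute w c d × b ≤ c) → ∃[ e ] SqBelt w v b e
  sqBelt-after-last-ladder path L@((s≤s {n = p} a≤p , f) , _) no-ladder (c , _ , ((c<d , g) , _) , b≤c)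
    with sqBelt⊎bareU-after path (f p a≤p ≤-refl) (g c ≤-refl c<d) b≤c
  ... | inj₁ (e , sq , _) = e , sq
  ... | inj₂ (r , p<r , _ , rU) with maxRun-around rU
  ...   | c′ , d′ , L′ , c′≤r , r<d′ with suc p ≤? c′
  ...     | yes b≤c′ = ⊥-elim (no-ladder c′ d′ L′ b≤c′)
  ...     | no b≰c′
            with maxRun-absorbs L (proj₁ L′) (<⇒≤ (≰⇒> b≰c′)) (<⇒≤ (≤-<-trans a≤p (<-trans p<r r<d′)))
  ...       | _ , d′≤b = ⊥-elim (<⇒≱ r<d′ (≤-trans d′≤b p<r))

  sqBelt-before-first-chute : ∀ {v a b} → IsPath w v → Chute w a b →
    (∀ c d → Chute w c d → d ≤ a → ⊥) → ∃[ c ] ∃[ d ] (Ladder w c d × d ≤ a) → ∃[ e ] SqBelt w v e a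
  sqBelt-before-first-chute {a = a} path C@((a<b , f) , _) no-chute (_ , _ , ((s≤s {n = p} c≤p , g) , _) , p<a)
    with sqBelt⊎bareD-before path (proj₂ (g p c≤p ≤-refl)) (f a ≤-refl a<b) p<a
  ... | inj₁ sq = sq
  ... | inj₂ (r , r<a , rD) with maxRun-around rD
  ...   | c′ , d′ , C′ , c′≤r , r<d′ with d′ ≤? a
  ...     | yes d′≤a = ⊥-elim (no-chute c′ d′ C′ d′≤a)
  ...     | no d′≰a
            with maxRun-absorbs C (proj₁ C′) (≤-trans c′≤r (<⇒≤ (<-trans r<a a<b))) (<⇒≤ (≰⇒> d′≰a))
  ...       | a≤c′ , _ = ⊥-elim (<⇒≱ (≤-<-trans c′≤r r<a) a≤c′)

  sqBelt-between-ladder-and-chute : ∀ {v a b} → IsPath w v → Ladder w 0 a → Chute w b (length w) → a ≤ b →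
    ∃[ c ] ∃[ d ] (SqBelt w v c d × a ≤ c × d ≤ b)
  sqBelt-between-ladder-and-chute path ((s≤s {n = p} _ , f) , _) ((b<l , g) , _) a≤b =
    sqBelt-between path (f p z≤n ≤-refl) (g _ ≤-refl b<l) a≤b

corollary10 : (w : List Step) (v : ℕ → ℕ) → IsPath w v →
    ((a b : ℕ) → Ladder w a b →
       (∀ c d → Ladder w c d → b ≤ c → ⊥) →
       (∃[ c ] ∃[ d ] (Chute w c d × b ≤ c)) →
       ∃[ e ] SqBelt w v b e)
  × ((a b : ℕ) → Chute w a b →
       (∀ c d → Chute w c d → d ≤ a → ⊥) →
       (∃[ c ] ∃[ d ] (Ladder w c d × d ≤ a)) →
       ∃[ e ] SqBelt w v e a)
  × ((a b : ℕ) → Ladder w 0 a → Chute w b (length w) → a ≤ b →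
       ∃[ c ] ∃[ d ] (SqBelt w v c d × a ≤ c × d ≤ b))
corollary10 w v path =
    (λ a b → sqBelt-after-last-ladder {w} path)
  , (λ a b → sqBelt-before-first-chute {w} path)
  , (λ a b → sqBelt-between-ladder-and-chute {w} path)
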